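{- Let $G_1$ be a finite simple graph with $n_1$ vertices and $m_1$ edges, and $G_2$ a finite simple graph with $n_2$ vertices and $m_2$ edges. Assume both $G_1$ and $G_2$ are connected with diameter at least $2$. Then $$H(G_1\oplus G_2,x)=(m_1+m_2+n_1n_2)\,x+\tfrac12\left(n_1^2+n_2^2-n_1-n_2-2m_1-2m_2\right)x^2$$ and $$H(\mu(G_1\oplus G_2),x)=(3m_1+3m_2+3n_1n_2+n_1+n_2)\,x+\left(2n_1^2+2n_2^2+n_1n_2-3m_1-3m_2\right)x^2 .$$
   Context: For a graph $G$ and an integer $k\ge 1$, $d(G,k)$ denotes the number of unordered pairs of distinct vertices of $G$ at distance exactly $k$. The Hosoya polynomial of a graph $G$ of diameter $D$ is $H(G,x)=\sum_{k=1}^{D} d(G,k)\,x^k$. The join $G_1\oplus G_2$ of graphs with disjoint vertex sets has vertex set $V(G_1)\cup V(G_2)$ and edge set $E(G_1)\cup E(G_2)\cup\{v_1v_2 : v_1\in V(G_1), v_2\in V(G_2)\}$. The Mycielskian graph $\mu(G)$ of a graph $G$ with vertex set $\{v_1,\dots,v_n\}$ has vertex set $\{v_1,\dots,v_n,u_1,\dots,u_n,w\}$ and edge set $E(G)\cup\{wu_i : 1\le i\le n\}\cup\{u_iv_j,\ u_jv_i : v_iv_j\in E(G)\}$. -}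

module Defs where

open import Data.Nat as ℕ using (ℕ; zero; suc; _+_; _*_)
open import Data.Bool using (Bool; true; false; _∧_; _∨_; not; if_then_else_)
open import Data.Fin as Fin using (Fin; toℕ; splitAt)
open import Data.Sum using (_⊎_; inj₁; inj₂)
open import Data.List using (List; map)
open import Data.Nat.ListAction using (sum)
open import Data.Bool.ListAction using (any)
open import Data.Integer using (+_)
open import Data.Fin.Base using ()
open import Data.List using ()
open import Data.Fin.Properties using (_≟_)
open import Relation.Nullary.Decidable using (⌊_⌋)
open import Relation.Binary.PropositionalEquality using (_≡_)
open import Data.Product using (Σ; ∃; _×_)
open import Data.Rational using (ℚ)
import Data.Rational as ℚ
import Data.List as L

record Graph (n : ℕ) : Set where
  field
    adj   : Fin n → Fin n → Bool
    sym   : ∀ u v → adj u v ≡ adj v u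
    irrfl : ∀ u → adj u u ≡ false
open Graph public

countPairs : ∀ {n} → (Fin n → Fin n → Bool) → ℕ
countPairs {n} P =
  sum (map (λ i → sum (map (λ j → if (toℕ i ℕ.<ᵇ toℕ j) ∧ P i j then 1 else 0)
                           (L.allFin n)))
           (L.allFin n))

numEdges : ∀ {n} → Graph n → ℕ
numEdges G = countPairs (adj G)

reach : ∀ {n} → Graph n → ℕ → Fin n → Fin n → Bool
reach G zero    u v = ⌊ u ≟ v ⌋
reach {n} G (suc k) u v =
  reach G k u v ∨ any (λ w → reach G k u w ∧ adj G w v) (L.allFin n)

distIs : ∀ {n} → Graph n → ℕ → Fin n → Fin n → Bool
distIs G zero    u v = reach G zero u v
distIs G (suc k) u v = reach G (suc k) u v ∧ not (reach G k u v)

d : ∀ {n} → Graph n → ℕ → ℕ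
d G k = countPairs (distIs G k)

Connected : ∀ {n} → Graph n → Set
Connected G = ∀ u v → ∃ λ k → reach G k u v ≡ true

DiamAtLeast2 : ∀ {n} → Graph n → Set
DiamAtLeast2 G = ∃ λ u → ∃ λ v → reach G 1 u v ≡ false

-- Hosoya polynomial as its coefficient sequence: coefficient of x^k.
-- H(G,x) = Σ_{k=1}^{D} d(G,k) x^k; the constant coefficient is 0 and
-- d(G,k) = 0 for k > D automatically.
hosoya : ∀ {n} → Graph n → ℕ → ℚ
hosoya G zero    = ℚ.0ℚ
hosoya G (suc k) = (+ d G (suc k)) ℚ./ 1

linQuad : ℚ → ℚ → ℕ → ℚ
linQuad a b 1 = a
linQuad a b 2 = b
linQuad a b _ = ℚ.0ℚ

joinAdj : ∀ {n₁ n₂} → Graph n₁ → Graph n₂ → Fin n₁ ⊎ Fin n₂ → Fin n₁ ⊎ Fin n₂ → Bool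
joinAdj G₁ G₂ (inj₁ a) (inj₁ b) = adj G₁ a b
joinAdj G₁ G₂ (inj₂ a) (inj₂ b) = adj G₂ a b
joinAdj G₁ G₂ (inj₁ a) (inj₂ b) = true
joinAdj G₁ G₂ (inj₂ a) (inj₁ b) = true

joinAdj-sym : ∀ {n₁ n₂} (G₁ : Graph n₁) (G₂ : Graph n₂) x y →
              joinAdj G₁ G₂ x y ≡ joinAdj G₁ G₂ y x
joinAdj-sym G₁ G₂ (inj₁ a) (inj₁ b) = sym G₁ a b
joinAdj-sym G₁ G₂ (inj₂ a) (inj₂ b) = sym G₂ a b
joinAdj-sym G₁ G₂ (inj₁ a) (inj₂ b) = Relation.Binary.PropositionalEquality.refl
joinAdj-sym G₁ G₂ (inj₂ a) (inj₁ b) = Relation.Binary.PropositionalEquality.refl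

joinAdj-irr : ∀ {n₁ n₂} (G₁ : Graph n₁) (G₂ : Graph n₂) x → joinAdj G₁ G₂ x x ≡ false
joinAdj-irr G₁ G₂ (inj₁ a) = irrfl G₁ a
joinAdj-irr G₁ G₂ (inj₂ a) = irrfl G₂ a

_⊕_ : ∀ {n₁ n₂} → Graph n₁ → Graph n₂ → Graph (n₁ + n₂)
_⊕_ {n₁} G₁ G₂ = record
  { adj   = λ u v → joinAdj G₁ G₂ (splitAt n₁ u) (splitAt n₁ v)
  ; sym   = λ u v → joinAdj-sym G₁ G₂ (splitAt n₁ u) (splitAt n₁ v)
  ; irrfl = λ u → joinAdj-irr G₁ G₂ (splitAt n₁ u)
  }

data MV (n : ℕ) : Set where
  vv : Fin n → MV n
  uu : Fin n → MV n
  ww : MV n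

toMV : ∀ {n} → Fin (n + n + 1) → MV n
toMV {n} x with splitAt (n + n) x
... | inj₂ _ = ww
... | inj₁ y with splitAt n y
...   | inj₁ i = vv i
...   | inj₂ i = uu i

myAdj : ∀ {n} → Graph n → MV n → MV n → Bool
myAdj G (vv i) (vv j) = adj G i j
myAdj G (vv i) (uu j) = adj G i j
myAdj G (uu i) (vv j) = adj G i j
myAdj G (uu i) (uu j) = false
myAdj G (uu i) ww     = true
myAdj G ww     (uu j) = true
myAdj G (vv i) ww     = false
myAdj G ww     (vv j) = false
myAdj G ww     ww     = false

myAdj-sym : ∀ {n} (G : Graph n) x y → myAdj G x y ≡ myAdj G y x
myAdj-sym G (vv i) (vv j) = sym G i j
myAdj-sym G (vv i) (uu j) = sym G i j
myAdj-sym G (uu i) (vv j) = sym G i j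
myAdj-sym G (uu i) (uu j) = Relation.Binary.PropositionalEquality.refl
myAdj-sym G (uu i) ww     = Relation.Binary.PropositionalEquality.refl
myAdj-sym G ww     (uu j) = Relation.Binary.PropositionalEquality.refl
myAdj-sym G (vv i) ww     = Relation.Binary.PropositionalEquality.refl
myAdj-sym G ww     (vv j) = Relation.Binary.PropositionalEquality.refl
myAdj-sym G ww     ww     = Relation.Binary.PropositionalEquality.refl

myAdj-irr : ∀ {n} (G : Graph n) x → myAdj G x x ≡ false
myAdj-irr G (vv i) = irrfl G i
myAdj-irr G (uu i) = Relation.Binary.PropositionalEquality.refl
myAdj-irr G ww     = Relation.Binary.PropositionalEquality.refl

μ : ∀ {n} → Graph n → Graph (n + n + 1)
μ G = record
  { adj   = λ x y → myAdj G (toMV x) (toMV y)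
  ; sym   = λ x y → myAdj-sym G (toMV x) (toMV y)
  ; irrfl = λ x → myAdj-irr G (toMV x)
  }

-- Both G₁ ⊕ G₂ and μ(G₁ ⊕ G₂) have the property that any two vertices are adjacent or
-- have a common neighbour: in the join a path goes through the other side, in the
-- Mycielskian through the copies uᵢ and w, using that the join has no isolated vertex.
-- In such a graph with n vertices and m edges d(G,1) = m, d(G,2) = n(n-1)/2 - m and
-- d(G,k) = 0 for k ≥ 3, so only the edge counts remain to be found:
-- |E(G₁ ⊕ G₂)| = m₁ + m₂ + n₁n₂ and |E(μ(H))| = 3|E(H)| + |V(H)|.
module Submission where

module DiameterTwo where

  open import Defs hiding (sym)
  open import Data.Bool using (Bool; true; false; _∧_; _∨_; not; if_then_else_; T)
  open import Data.Bool.Properties using (∧-zeroʳ; ∨-zeroʳ; ∧-identityʳ)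
  open import Data.Bool.ListAction using (any)
  open import Data.Fin as Fin using (Fin; zero; suc; toℕ; splitAt; _↑ˡ_; _↑ʳ_)
  open import Data.Fin.Properties
    using (_≟_; _<?_; <-cmp; <-irrefl; <⇒≢; splitAt-↑ˡ; splitAt-↑ʳ; splitAt-join)
  import Data.List as L using (map; tabulate; allFin)
  open import Data.List using (List; []; _∷_)
  open import Data.List.Properties using (map-cong)
  open import Data.List.Membership.Propositional using (_∈_)
  open import Data.List.Membership.Propositional.Properties using (∈-allFin)
  open import Data.List.Relation.Unary.Any using (here; there)
  open import Data.Nat using (ℕ; zero; suc; _+_; _*_)
  import Data.Nat.ListAction as NatList
  open import Data.Nat.Properties as ℕₚ
    using (+-assoc; +-identityʳ; *-identityʳ; +-cancelˡ-≡; +-cancelʳ-≡; <ᵇ⇒<)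
  open import Data.Nat.Tactic.RingSolver using (solve-∀)
  open import Algebra.Properties.CommutativeMonoid.Sum ℕₚ.+-0-commutativeMonoid
    using (sum-syntax; sum-cong-≗; sum-replicate-zero; ∑-distrib-+; ∑-comm)
  open import Data.Product using (∃; _×_; _,_)
  open import Data.Sum using (_⊎_; inj₁; inj₂)
  open import Function using (_∘_; id)
  open import Relation.Binary.Definitions using (tri<; tri≈; tri>)
  open import Relation.Nullary using (yes; no)
  open import Relation.Nullary.Decidable using (⌊_⌋; does; dec-true; dec-false; isYes≗does)
  open import Relation.Binary.PropositionalEquality

  sum-map-tabulate : ∀ {A : Set} {n} (g : Fin n → A) (f : A → ℕ) →
                     NatList.sum (L.map f (L.tabulate g)) ≡ ∑[ i < n ] f (g i)
  sum-map-tabulate {n = zero}  g f = refl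
  sum-map-tabulate {n = suc n} g f = cong (f (g zero) +_) (sum-map-tabulate (g ∘ suc) f)

  ∑-↑ : ∀ a {b} (f : Fin (a + b) → ℕ) →
        ∑[ k < a + b ] f k ≡ ∑[ i < a ] f (i ↑ˡ b) + ∑[ j < b ] f (a ↑ʳ j)
  ∑-↑ zero    f = refl
  ∑-↑ (suc a) f = trans (cong (f zero +_) (∑-↑ a (f ∘ suc))) (sym (+-assoc (f zero) _ _))

  ∑-const : ∀ n c → ∑[ i < n ] c ≡ n * c
  ∑-const zero    c = refl
  ∑-const (suc n) c = cong (c +_) (∑-const n c)

  ∑∑-1 : ∀ a b → ∑[ i < a ] ∑[ j < b ] 1 ≡ a * b
  ∑∑-1 a b = trans (sum-cong-≗ {a} (λ _ → trans (∑-const b 1) (*-identityʳ b))) (∑-const a b)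

  -- Counting pairs

  𝟙 : Bool → ℕ
  𝟙 b = if b then 1 else 0

  -- Computes to the test toℕ i <ᵇ toℕ j made by countPairs.
  _≺_ : ∀ {n} → Fin n → Fin n → Bool
  i ≺ j = does (i <? j)

  ≺⇒< : ∀ {n} {i j : Fin n} → i ≺ j ≡ true → i Fin.< j
  ≺⇒< {i = i} {j} i≺j = <ᵇ⇒< (toℕ i) (toℕ j) (subst T (sym i≺j) _)

  ≺-irrefl : ∀ {n} (i : Fin n) → i ≺ i ≡ false
  ≺-irrefl i = dec-false (i <? i) (<-irrefl refl)

  ↑ˡ≺↑ˡ : ∀ {a} b (i j : Fin a) → (i ↑ˡ b) ≺ (j ↑ˡ b) ≡ i ≺ j
  ↑ˡ≺↑ˡ b zero    zero    = refl
  ↑ˡ≺↑ˡ b zero    (suc j) = refl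
  ↑ˡ≺↑ˡ b (suc i) zero    = refl
  ↑ˡ≺↑ˡ b (suc i) (suc j) = ↑ˡ≺↑ˡ b i j

  ↑ʳ≺↑ʳ : ∀ a {b} (i j : Fin b) → (a ↑ʳ i) ≺ (a ↑ʳ j) ≡ i ≺ j
  ↑ʳ≺↑ʳ zero    i j = refl
  ↑ʳ≺↑ʳ (suc a) i j = ↑ʳ≺↑ʳ a i j

  ↑ˡ≺↑ʳ : ∀ {a b} (i : Fin a) (j : Fin b) → (i ↑ˡ b) ≺ (a ↑ʳ j) ≡ true
  ↑ˡ≺↑ʳ zero    j = refl
  ↑ˡ≺↑ʳ (suc i) j = ↑ˡ≺↑ʳ i j

  ↑ʳ≺↑ˡ : ∀ {a b} (i : Fin a) (j : Fin b) → (a ↑ʳ j) ≺ (i ↑ˡ b) ≡ false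
  ↑ʳ≺↑ˡ zero    j = refl
  ↑ʳ≺↑ˡ (suc i) j = ↑ʳ≺↑ˡ i j

  countPairs-∑ : ∀ {n} (P : Fin n → Fin n → Bool) →
                 countPairs P ≡ ∑[ i < n ] ∑[ j < n ] 𝟙 (i ≺ j ∧ P i j)
  countPairs-∑ {n} P = trans (cong NatList.sum (map-cong row (L.allFin n)))
                             (sum-map-tabulate {n = n} id (λ i → ∑[ j < n ] 𝟙 (i ≺ j ∧ P i j)))
    where
    row : ∀ i → NatList.sum (L.map (λ j → 𝟙 (i ≺ j ∧ P i j)) (L.allFin n))
              ≡ ∑[ j < n ] 𝟙 (i ≺ j ∧ P i j)
    row i = sum-map-tabulate {n = n} id (λ j → 𝟙 (i ≺ j ∧ P i j))

  countPairs-cong : ∀ {n} {P Q : Fin n → Fin n → Bool} →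
                    (∀ i j → i Fin.< j → P i j ≡ Q i j) → countPairs P ≡ countPairs Q
  countPairs-cong {n} {P} {Q} P≡Q =
    cong NatList.sum (map-cong (λ i → cong NatList.sum (map-cong (pointwise i) (L.allFin n)))
                            (L.allFin n))
    where
    pointwise : ∀ i j → 𝟙 (i ≺ j ∧ P i j) ≡ 𝟙 (i ≺ j ∧ Q i j)
    pointwise i j with i ≺ j in i≺j
    ... | true  = cong 𝟙 (P≡Q i j (≺⇒< i≺j))
    ... | false = refl

  countPairs-false : ∀ {n} (P : Fin n → Fin n → Bool) →
                     (∀ i j → i Fin.< j → P i j ≡ false) → countPairs P ≡ 0
  countPairs-false {n} P P≡false = begin
    countPairs P
      ≡⟨ countPairs-cong P≡false ⟩
    countPairs {n} (λ _ _ → false)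
      ≡⟨ countPairs-∑ {n} (λ _ _ → false) ⟩
    ∑[ i < n ] ∑[ j < n ] 𝟙 (i ≺ j ∧ false)
      ≡⟨ sum-cong-≗ {n} (λ i → sum-cong-≗ {n} (λ j → cong 𝟙 (∧-zeroʳ (i ≺ j)))) ⟩
    ∑[ i < n ] ∑[ j < n ] 0
      ≡⟨ sum-cong-≗ {n} (λ _ → sum-replicate-zero n) ⟩
    ∑[ i < n ] 0
      ≡⟨ sum-replicate-zero n ⟩
    0 ∎
    where open ≡-Reasoning

  numPairs : ℕ → ℕ
  numPairs n = countPairs {n} (λ _ _ → true)

  countPairs-+-not : ∀ {n} (P : Fin n → Fin n → Bool) →
                     countPairs P + countPairs (λ i j → not (P i j)) ≡ numPairs n
  countPairs-+-not {n} P = sym (begin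
    numPairs n
      ≡⟨ countPairs-∑ {n} (λ _ _ → true) ⟩
    ∑[ i < n ] ∑[ j < n ] 𝟙 (i ≺ j ∧ true)
      ≡⟨ sum-cong-≗ {n} (λ i → sum-cong-≗ {n} (λ j → 𝟙-split (i ≺ j) (P i j))) ⟩
    ∑[ i < n ] ∑[ j < n ] (Yes i j + No i j)
      ≡⟨ sum-cong-≗ {n} (λ i → ∑-distrib-+ (Yes i) (No i)) ⟩
    ∑[ i < n ] (∑[ j < n ] Yes i j + ∑[ j < n ] No i j)
      ≡⟨ ∑-distrib-+ (λ i → ∑[ j < n ] Yes i j) (λ i → ∑[ j < n ] No i j) ⟩
    ∑[ i < n ] ∑[ j < n ] Yes i j + ∑[ i < n ] ∑[ j < n ] No i j
      ≡⟨ sym (cong₂ _+_ (countPairs-∑ P) (countPairs-∑ (λ i j → not (P i j)))) ⟩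
    countPairs P + countPairs (λ i j → not (P i j)) ∎)
    where
    open ≡-Reasoning
    Yes No : Fin n → Fin n → ℕ
    Yes i j = 𝟙 (i ≺ j ∧ P i j)
    No  i j = 𝟙 (i ≺ j ∧ not (P i j))
    𝟙-split : ∀ b x → 𝟙 (b ∧ true) ≡ 𝟙 (b ∧ x) + 𝟙 (b ∧ not x)
    𝟙-split false x     = refl
    𝟙-split true  false = refl
    𝟙-split true  true  = refl

  countPairs-↑ : ∀ a b (P : Fin (a + b) → Fin (a + b) → Bool) →
    countPairs P ≡ countPairs (λ i j → P (i ↑ˡ b) (j ↑ˡ b))
                 + ∑[ i < a ] ∑[ j < b ] 𝟙 (P (i ↑ˡ b) (a ↑ʳ j))
                 + countPairs (λ i j → P (a ↑ʳ i) (a ↑ʳ j))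
  countPairs-↑ a b P = begin
    countPairs P
      ≡⟨ countPairs-∑ P ⟩
    ∑[ k < a + b ] row k
      ≡⟨ ∑-↑ a row ⟩
    ∑[ i < a ] row (i ↑ˡ b) + ∑[ j < b ] row (a ↑ʳ j)
      ≡⟨ cong₂ _+_ (sum-cong-≗ {a} leftRow) (sum-cong-≗ {b} rightRow) ⟩
    ∑[ i < a ] (Left i + Cross i) + ∑[ j < b ] Right j
      ≡⟨ cong (_+ ∑[ j < b ] Right j) (∑-distrib-+ Left Cross) ⟩
    ∑[ i < a ] Left i + ∑[ i < a ] Cross i + ∑[ j < b ] Right j
      ≡⟨ sym (cong₂ (λ l r → l + ∑[ i < a ] Cross i + r)
                    (countPairs-∑ (λ i j → P (i ↑ˡ b) (j ↑ˡ b)))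
                    (countPairs-∑ (λ i j → P (a ↑ʳ i) (a ↑ʳ j)))) ⟩
    countPairs (λ i j → P (i ↑ˡ b) (j ↑ˡ b)) + ∑[ i < a ] Cross i
      + countPairs (λ i j → P (a ↑ʳ i) (a ↑ʳ j)) ∎
    where
    open ≡-Reasoning
    row : Fin (a + b) → ℕ
    row k = ∑[ l < a + b ] 𝟙 (k ≺ l ∧ P k l)
    Left Cross : Fin a → ℕ
    Left  i = ∑[ i′ < a ] 𝟙 (i ≺ i′ ∧ P (i ↑ˡ b) (i′ ↑ˡ b))
    Cross i = ∑[ j < b ] 𝟙 (P (i ↑ˡ b) (a ↑ʳ j))
    Right : Fin b → ℕ
    Right j = ∑[ j′ < b ] 𝟙 (j ≺ j′ ∧ P (a ↑ʳ j) (a ↑ʳ j′))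
    leftRow : ∀ i → row (i ↑ˡ b) ≡ Left i + Cross i
    leftRow i = trans (∑-↑ a _) (cong₂ _+_
      (sum-cong-≗ {a} (λ i′ → cong (λ c → 𝟙 (c ∧ P (i ↑ˡ b) (i′ ↑ˡ b))) (↑ˡ≺↑ˡ b i i′)))
      (sum-cong-≗ {b} (λ j → cong (λ c → 𝟙 (c ∧ P (i ↑ˡ b) (a ↑ʳ j))) (↑ˡ≺↑ʳ i j))))
    rightRow : ∀ j → row (a ↑ʳ j) ≡ Right j
    rightRow j = trans (∑-↑ a _) (cong₂ _+_
      (trans (sum-cong-≗ {a} (λ i → cong (λ c → 𝟙 (c ∧ P (a ↑ʳ j) (i ↑ˡ b))) (↑ʳ≺↑ˡ i j)))
             (sum-replicate-zero a))
      (sum-cong-≗ {b} (λ j′ → cong (λ c → 𝟙 (c ∧ P (a ↑ʳ j) (a ↑ʳ j′))) (↑ʳ≺↑ʳ a j j′))))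

  numPairs-+ : ∀ a b → numPairs (a + b) ≡ numPairs a + a * b + numPairs b
  numPairs-+ a b = trans (countPairs-↑ a b _) (cong (λ c → numPairs a + c + numPairs b) (∑∑-1 a b))

  numPairs-double : ∀ n → 2 * numPairs n + n ≡ n * n
  numPairs-double zero    = refl
  numPairs-double (suc n) = begin
    2 * numPairs (1 + n) + suc n   ≡⟨ cong (λ p → 2 * p + suc n) (numPairs-+ 1 n) ⟩
    2 * (1 * n + numPairs n) + suc n ≡⟨ regroup n (numPairs n) ⟩
    (2 * numPairs n + n) + (n + suc n) ≡⟨ cong (_+ (n + suc n)) (numPairs-double n) ⟩
    n * n + (n + suc n)             ≡⟨ square n ⟩
    suc n * suc n                   ∎
    where
    open ≡-Reasoning
    regroup : ∀ n p → 2 * (1 * n + p) + suc n ≡ (2 * p + n) + (n + suc n)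
    regroup = solve-∀
    square : ∀ n → n * n + (n + suc n) ≡ suc n * suc n
    square = solve-∀

  ∑∑-adj : ∀ {n} (G : Graph n) → ∑[ i < n ] ∑[ j < n ] 𝟙 (adj G i j) ≡ numEdges G + numEdges G
  ∑∑-adj {n} G = begin
    ∑[ i < n ] ∑[ j < n ] 𝟙 (adj G i j)
      ≡⟨ sum-cong-≗ {n} (λ i → sum-cong-≗ {n} (λ j → split i j)) ⟩
    ∑[ i < n ] ∑[ j < n ] (E i j + E j i)
      ≡⟨ sum-cong-≗ {n} (λ i → ∑-distrib-+ (E i) (λ j → E j i)) ⟩
    ∑[ i < n ] (∑[ j < n ] E i j + ∑[ j < n ] E j i)
      ≡⟨ ∑-distrib-+ (λ i → ∑[ j < n ] E i j) (λ i → ∑[ j < n ] E j i) ⟩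
    ∑[ i < n ] ∑[ j < n ] E i j + ∑[ i < n ] ∑[ j < n ] E j i
      ≡⟨ cong (∑[ i < n ] ∑[ j < n ] E i j +_) (∑-comm (λ i j → E j i)) ⟩
    ∑[ i < n ] ∑[ j < n ] E i j + ∑[ j < n ] ∑[ i < n ] E j i
      ≡⟨ sym (cong₂ _+_ (countPairs-∑ (adj G)) (countPairs-∑ (adj G))) ⟩
    numEdges G + numEdges G ∎
    where
    open ≡-Reasoning
    E : Fin n → Fin n → ℕ
    E i j = 𝟙 (i ≺ j ∧ adj G i j)
    split : ∀ i j → 𝟙 (adj G i j) ≡ E i j + E j i
    split i j with <-cmp i j
    ... | tri< i<j _ j≮i = trans (sym (+-identityʳ _))
      (sym (cong₂ (λ x y → 𝟙 (x ∧ adj G i j) + 𝟙 (y ∧ adj G j i))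
                  (dec-true (i <? j) i<j) (dec-false (j <? i) j≮i)))
    ... | tri> i≮j _ j<i = trans (cong 𝟙 (Graph.sym G i j))
      (sym (cong₂ (λ x y → 𝟙 (x ∧ adj G i j) + 𝟙 (y ∧ adj G j i))
                  (dec-false (i <? j) i≮j) (dec-true (j <? i) j<i)))
    ... | tri≈ _ refl _ = trans (cong 𝟙 (irrfl G i))
      (sym (cong (λ x → 𝟙 (x ∧ adj G i i) + 𝟙 (x ∧ adj G i i)) (≺-irrefl i)))

  -- Walks of length at most two

  any-∈ : ∀ {A : Set} (p : A → Bool) {x : A} {xs : List A} →
          x ∈ xs → p x ≡ true → any p xs ≡ true
  any-∈ p {xs = _ ∷ xs} (here refl) px = cong (_∨ any p xs) px
  any-∈ p {xs = y ∷ ys} (there x∈ys) px = trans (cong (p y ∨_) (any-∈ p x∈ys px)) (∨-zeroʳ (p y))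

  any-false : ∀ {A : Set} (p : A → Bool) (xs : List A) → (∀ x → p x ≡ false) → any p xs ≡ false
  any-false p []       p≡false = refl
  any-false p (x ∷ xs) p≡false rewrite p≡false x = any-false p xs p≡false

  ⌊≟⌋-refl : ∀ {n} (u : Fin n) → ⌊ u ≟ u ⌋ ≡ true
  ⌊≟⌋-refl u = trans (isYes≗does (u ≟ u)) (dec-true (u ≟ u) refl)

  ⌊≟⌋-≢ : ∀ {n} {u v : Fin n} → u ≢ v → ⌊ u ≟ v ⌋ ≡ false
  ⌊≟⌋-≢ {u = u} {v} u≢v = trans (isYes≗does (u ≟ v)) (dec-false (u ≟ v) u≢v)

  any-≟∧ : ∀ {n} (u : Fin n) (f : Fin n → Bool) →
           any (λ w → ⌊ u ≟ w ⌋ ∧ f w) (L.allFin n) ≡ f u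
  any-≟∧ {n} u f with f u in fu
  ... | true  = any-∈ _ (∈-allFin u) (trans (cong (_∧ f u) (⌊≟⌋-refl u)) fu)
  ... | false = any-false _ (L.allFin n) only-u
    where
    only-u : ∀ w → ⌊ u ≟ w ⌋ ∧ f w ≡ false
    only-u w with u ≟ w
    ... | yes refl = fu
    ... | no  _    = refl

  -- For x = y this says that x has a neighbour.
  WithinTwoSteps : {A : Set} → (A → A → Bool) → Set
  WithinTwoSteps R = ∀ x y → R x y ≡ true ⊎ ∃ λ z → R x z ≡ true × R z y ≡ true

  WithinTwoSteps-∘ : ∀ {A B : Set} {R : B → B → Bool} (f : A → B) (g : B → A) →
                     (∀ y → f (g y) ≡ y) →
                     WithinTwoSteps R → WithinTwoSteps (λ x x′ → R (f x) (f x′))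
  WithinTwoSteps-∘ {R = R} f g f∘g≡id within x x′ with within (f x) (f x′)
  ... | inj₁ xx′           = inj₁ xx′
  ... | inj₂ (z , xz , zx′) = inj₂ (g z , subst (λ y → R (f x) y ≡ true) (sym (f∘g≡id z)) xz
                                       , subst (λ y → R y (f x′) ≡ true) (sym (f∘g≡id z)) zx′)

  module _ {n} (G : Graph n) where

    reach-1 : ∀ u v → reach G 1 u v ≡ ⌊ u ≟ v ⌋ ∨ adj G u v
    reach-1 u v = cong (⌊ u ≟ v ⌋ ∨_) (any-≟∧ u (λ w → adj G w v))

    reach-1-≢ : ∀ {u v} → u ≢ v → reach G 1 u v ≡ adj G u v
    reach-1-≢ {u} {v} u≢v = trans (reach-1 u v) (cong (_∨ adj G u v) (⌊≟⌋-≢ u≢v))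

    reach-adj : ∀ {u v} → adj G u v ≡ true → reach G 1 u v ≡ true
    reach-adj {u} {v} uv = trans (reach-1 u v) (trans (cong (⌊ u ≟ v ⌋ ∨_) uv) (∨-zeroʳ _))

    reach-suc : ∀ k {u v} → reach G k u v ≡ true → reach G (suc k) u v ≡ true
    reach-suc k {u} {v} r = cong (_∨ any (λ w → reach G k u w ∧ adj G w v) (L.allFin n)) r

    reach-2+ : WithinTwoSteps (adj G) → ∀ k u v → reach G (2 + k) u v ≡ true
    reach-2+ within zero u v with within u v
    ... | inj₁ uv           = reach-suc 1 (reach-adj uv)
    ... | inj₂ (w , uw , wv) = trans (cong (reach G 1 u v ∨_)
      (any-∈ (λ x → reach G 1 u x ∧ adj G x v) (∈-allFin w) (cong₂ _∧_ (reach-adj uw) wv)))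
      (∨-zeroʳ _)
    reach-2+ within (suc k) u v = reach-suc (2 + k) (reach-2+ within k u v)

    d-1 : d G 1 ≡ numEdges G
    d-1 = countPairs-cong λ u v u<v →
      trans (cong₂ (λ r e → r ∧ not e) (reach-1-≢ (<⇒≢ u<v)) (⌊≟⌋-≢ (<⇒≢ u<v)))
            (∧-identityʳ _)

    numEdges-+-d-2 : WithinTwoSteps (adj G) → numEdges G + d G 2 ≡ numPairs n
    numEdges-+-d-2 within =
      trans (cong (numEdges G +_) d-2≡nonEdges) (countPairs-+-not (adj G))
      where
      d-2≡nonEdges : d G 2 ≡ countPairs (λ u v → not (adj G u v))
      d-2≡nonEdges = countPairs-cong λ u v u<v →
        cong₂ (λ r₂ r₁ → r₂ ∧ not r₁) (reach-2+ within 0 u v) (reach-1-≢ (<⇒≢ u<v))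

    d-3+ : WithinTwoSteps (adj G) → ∀ k → d G (3 + k) ≡ 0
    d-3+ within k = countPairs-false _ λ u v _ →
      trans (cong (λ r → reach G (3 + k) u v ∧ not r) (reach-2+ within k u v)) (∧-zeroʳ _)

  -- Joins

  module _ {n₁ n₂} (G₁ : Graph n₁) (G₂ : Graph n₂) where

    joinAdj-withinTwoSteps : Fin n₁ → Fin n₂ → WithinTwoSteps (joinAdj G₁ G₂)
    joinAdj-withinTwoSteps a b (inj₁ x) (inj₁ y) = inj₂ (inj₂ b , refl , refl)
    joinAdj-withinTwoSteps a b (inj₁ x) (inj₂ y) = inj₁ refl
    joinAdj-withinTwoSteps a b (inj₂ x) (inj₁ y) = inj₁ refl
    joinAdj-withinTwoSteps a b (inj₂ x) (inj₂ y) = inj₂ (inj₁ a , refl , refl)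

    ⊕-withinTwoSteps : Fin n₁ → Fin n₂ → WithinTwoSteps (adj (G₁ ⊕ G₂))
    ⊕-withinTwoSteps a b = WithinTwoSteps-∘ (splitAt n₁) (Fin.join n₁ n₂) (splitAt-join n₁ n₂)
                                             (joinAdj-withinTwoSteps a b)

    numEdges-⊕ : numEdges (G₁ ⊕ G₂) ≡ numEdges G₁ + numEdges G₂ + n₁ * n₂
    numEdges-⊕ = begin
      numEdges (G₁ ⊕ G₂)                   ≡⟨ countPairs-↑ n₁ n₂ (adj (G₁ ⊕ G₂)) ⟩
      _                                    ≡⟨ cong₂ _+_ (cong₂ _+_ left cross) right ⟩
      numEdges G₁ + n₁ * n₂ + numEdges G₂  ≡⟨ swap (numEdges G₁) (n₁ * n₂) (numEdges G₂) ⟩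
      numEdges G₁ + numEdges G₂ + n₁ * n₂  ∎
      where
      open ≡-Reasoning
      left : countPairs (λ i j → adj (G₁ ⊕ G₂) (i ↑ˡ n₂) (j ↑ˡ n₂)) ≡ numEdges G₁
      left = countPairs-cong λ i j _ →
        cong₂ (joinAdj G₁ G₂) (splitAt-↑ˡ n₁ i n₂) (splitAt-↑ˡ n₁ j n₂)
      cross : ∑[ i < n₁ ] ∑[ j < n₂ ] 𝟙 (adj (G₁ ⊕ G₂) (i ↑ˡ n₂) (n₁ ↑ʳ j)) ≡ n₁ * n₂
      cross = trans (sum-cong-≗ {n₁} λ i → sum-cong-≗ {n₂} λ j →
                       cong 𝟙 (cong₂ (joinAdj G₁ G₂) (splitAt-↑ˡ n₁ i n₂) (splitAt-↑ʳ n₁ n₂ j)))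
                    (∑∑-1 n₁ n₂)
      right : countPairs (λ i j → adj (G₁ ⊕ G₂) (n₁ ↑ʳ i) (n₁ ↑ʳ j)) ≡ numEdges G₂
      right = countPairs-cong λ i j _ →
        cong₂ (joinAdj G₁ G₂) (splitAt-↑ʳ n₁ n₂ i) (splitAt-↑ʳ n₁ n₂ j)
      swap : ∀ a x b → a + x + b ≡ a + b + x
      swap = solve-∀

    d-2-⊕ : Fin n₁ → Fin n₂ →
            numEdges G₁ + numEdges G₂ + d (G₁ ⊕ G₂) 2 ≡ numPairs n₁ + numPairs n₂
    d-2-⊕ a b = +-cancelˡ-≡ (n₁ * n₂) _ _ (begin
      n₁ * n₂ + (m₁ + m₂ + e)       ≡⟨ swap (n₁ * n₂) m₁ m₂ e ⟩
      m₁ + m₂ + n₁ * n₂ + e         ≡⟨ cong (_+ e) numEdges-⊕ ⟨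
      numEdges (G₁ ⊕ G₂) + e        ≡⟨ numEdges-+-d-2 (G₁ ⊕ G₂) (⊕-withinTwoSteps a b) ⟩
      numPairs (n₁ + n₂)            ≡⟨ numPairs-+ n₁ n₂ ⟩
      p₁ + n₁ * n₂ + p₂             ≡⟨ middle (n₁ * n₂) p₁ p₂ ⟨
      n₁ * n₂ + (p₁ + p₂)           ∎)
      where
      open ≡-Reasoning
      m₁ m₂ p₁ p₂ e : ℕ
      m₁ = numEdges G₁
      m₂ = numEdges G₂
      p₁ = numPairs n₁
      p₂ = numPairs n₂
      e  = d (G₁ ⊕ G₂) 2
      swap : ∀ x a b c → x + (a + b + c) ≡ a + b + x + c
      swap = solve-∀
      middle : ∀ x a b → x + (a + b) ≡ a + x + b
      middle = solve-∀

  -- Mycielskians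

  module _ {n} (G : Graph n) where

    neighbour : WithinTwoSteps (adj G) → ∀ i → ∃ λ k → adj G i k ≡ true
    neighbour within i with within i i
    ... | inj₁ ii with () ← trans (sym ii) (irrfl G i)
    ... | inj₂ (k , ik , _) = k , ik

    myAdj-withinTwoSteps : WithinTwoSteps (adj G) → Fin n → WithinTwoSteps (myAdj G)
    myAdj-withinTwoSteps within v₀ (vv i) (vv j) with within i j
    ... | inj₁ ij            = inj₁ ij
    ... | inj₂ (k , ik , kj) = inj₂ (vv k , ik , kj)
    myAdj-withinTwoSteps within v₀ (vv i) (uu j) with within i j
    ... | inj₁ ij            = inj₁ ij
    ... | inj₂ (k , ik , kj) = inj₂ (vv k , ik , kj)
    myAdj-withinTwoSteps within v₀ (uu i) (vv j) with within i j
    ... | inj₁ ij            = inj₁ ij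
    ... | inj₂ (k , ik , kj) = inj₂ (vv k , ik , kj)
    myAdj-withinTwoSteps within v₀ (vv i) ww with neighbour within i
    ... | k , ik = inj₂ (uu k , ik , refl)
    myAdj-withinTwoSteps within v₀ ww (vv j) with neighbour within j
    ... | k , jk = inj₂ (uu k , refl , trans (Graph.sym G k j) jk)
    myAdj-withinTwoSteps within v₀ (uu i) (uu j) = inj₂ (ww , refl , refl)
    myAdj-withinTwoSteps within v₀ (uu i) ww     = inj₁ refl
    myAdj-withinTwoSteps within v₀ ww     (uu j) = inj₁ refl
    myAdj-withinTwoSteps within v₀ ww     ww     = inj₂ (uu v₀ , refl , refl)

    toMV-vv : ∀ i → toMV ((i ↑ˡ n) ↑ˡ 1) ≡ vv i
    toMV-vv i rewrite splitAt-↑ˡ (n + n) (i ↑ˡ n) 1 | splitAt-↑ˡ n i n = refl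

    toMV-uu : ∀ i → toMV ((n ↑ʳ i) ↑ˡ 1) ≡ uu i
    toMV-uu i rewrite splitAt-↑ˡ (n + n) (n ↑ʳ i) 1 | splitAt-↑ʳ n n i = refl

    toMV-ww : ∀ j → toMV {n} ((n + n) ↑ʳ j) ≡ ww
    toMV-ww j rewrite splitAt-↑ʳ (n + n) 1 j = refl

    fromMV : MV n → Fin (n + n + 1)
    fromMV (vv i) = (i ↑ˡ n) ↑ˡ 1
    fromMV (uu i) = (n ↑ʳ i) ↑ˡ 1
    fromMV ww     = (n + n) ↑ʳ zero

    toMV-fromMV : ∀ x → toMV (fromMV x) ≡ x
    toMV-fromMV (vv i) = toMV-vv i
    toMV-fromMV (uu i) = toMV-uu i
    toMV-fromMV ww     = toMV-ww zero

    μ-withinTwoSteps : WithinTwoSteps (adj G) → Fin n → WithinTwoSteps (adj (μ G))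
    μ-withinTwoSteps within v₀ =
      WithinTwoSteps-∘ toMV fromMV toMV-fromMV (myAdj-withinTwoSteps within v₀)

    numEdges-μ : numEdges (μ G) ≡ 3 * numEdges G + n
    numEdges-μ = begin
      numEdges (μ G)
        ≡⟨ countPairs-↑ (n + n) 1 (adj (μ G)) ⟩
      countPairs (λ i j → adj (μ G) (i ↑ˡ 1) (j ↑ˡ 1))
        + ∑[ k < n + n ] ∑[ j < 1 ] 𝟙 (adj (μ G) (k ↑ˡ 1) ((n + n) ↑ʳ j)) + 0
        ≡⟨ cong₂ (λ a b → a + b + 0) vu-block w-column ⟩
      numEdges G + (numEdges G + numEdges G) + 0 + (0 + n * 1) + 0
        ≡⟨ collect (numEdges G) n ⟩
      3 * numEdges G + n ∎
      where
      open ≡-Reasoning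
      vv-vv : countPairs (λ i j → myAdj G (toMV ((i ↑ˡ n) ↑ˡ 1)) (toMV ((j ↑ˡ n) ↑ˡ 1))) ≡ numEdges G
      vv-vv = countPairs-cong λ i j _ → cong₂ (myAdj G) (toMV-vv i) (toMV-vv j)
      vv-uu : ∑[ i < n ] ∑[ j < n ] 𝟙 (myAdj G (toMV ((i ↑ˡ n) ↑ˡ 1)) (toMV ((n ↑ʳ j) ↑ˡ 1)))
              ≡ numEdges G + numEdges G
      vv-uu = trans (sum-cong-≗ {n} λ i → sum-cong-≗ {n} λ j →
                       cong 𝟙 (cong₂ (myAdj G) (toMV-vv i) (toMV-uu j)))
                    (∑∑-adj G)
      uu-uu : countPairs (λ i j → myAdj G (toMV ((n ↑ʳ i) ↑ˡ 1)) (toMV ((n ↑ʳ j) ↑ˡ 1))) ≡ 0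
      uu-uu = countPairs-false _ λ i j _ → cong₂ (myAdj G) (toMV-uu i) (toMV-uu j)
      vv-ww : ∑[ i < n ] (𝟙 (myAdj G (toMV ((i ↑ˡ n) ↑ˡ 1)) (toMV ((n + n) ↑ʳ zero))) + 0) ≡ 0
      vv-ww = trans (sum-cong-≗ {n} λ i →
                       cong (λ x → 𝟙 x + 0) (cong₂ (myAdj G) (toMV-vv i) (toMV-ww zero)))
                    (sum-replicate-zero n)
      uu-ww : ∑[ i < n ] (𝟙 (myAdj G (toMV ((n ↑ʳ i) ↑ˡ 1)) (toMV ((n + n) ↑ʳ zero))) + 0) ≡ n * 1
      uu-ww = trans (sum-cong-≗ {n} λ i →
                       cong (λ x → 𝟙 x + 0) (cong₂ (myAdj G) (toMV-uu i) (toMV-ww zero)))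
                    (∑-const n 1)
      vu-block : countPairs (λ i j → adj (μ G) (i ↑ˡ 1) (j ↑ˡ 1))
                 ≡ numEdges G + (numEdges G + numEdges G) + 0
      vu-block = trans (countPairs-↑ n n _) (cong₂ _+_ (cong₂ _+_ vv-vv vv-uu) uu-uu)
      w-column : ∑[ k < n + n ] ∑[ j < 1 ] 𝟙 (adj (μ G) (k ↑ˡ 1) ((n + n) ↑ʳ j)) ≡ 0 + n * 1
      w-column = trans (∑-↑ n _) (cong₂ _+_ vv-ww uu-ww)
      collect : ∀ m n → m + (m + m) + 0 + (0 + n * 1) + 0 ≡ 3 * m + n
      collect = solve-∀

    d-2-μ : WithinTwoSteps (adj G) → Fin n → d (μ G) 2 + 3 * numEdges G ≡ 2 * (n * n)
    d-2-μ within v₀ = +-cancelʳ-≡ n _ _ (begin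
      e + 3 * m + n
        ≡⟨ reorder e m n ⟩
      3 * m + n + e
        ≡⟨ cong (_+ e) numEdges-μ ⟨
      numEdges (μ G) + e
        ≡⟨ numEdges-+-d-2 (μ G) (μ-withinTwoSteps within v₀) ⟩
      numPairs (n + n + 1)
        ≡⟨ trans (numPairs-+ (n + n) 1) (cong (λ q → q + (n + n) * 1 + 0) (numPairs-+ n n)) ⟩
      numPairs n + n * n + numPairs n + (n + n) * 1 + 0
        ≡⟨ regroup (numPairs n) n ⟩
      (2 * numPairs n + n) + n * n + n
        ≡⟨ cong (λ q → q + n * n + n) (numPairs-double n) ⟩
      n * n + n * n + n
        ≡⟨ double (n * n) n ⟩
      2 * (n * n) + n ∎)
      where
      open ≡-Reasoning
      e m : ℕ
      e = d (μ G) 2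
      m = numEdges G
      reorder : ∀ e m n → e + 3 * m + n ≡ 3 * m + n + e
      reorder = solve-∀
      regroup : ∀ p n → p + n * n + p + (n + n) * 1 + 0 ≡ (2 * p + n) + n * n + n
      regroup = solve-∀
      double : ∀ s n → s + s + n ≡ 2 * s + n
      double = solve-∀

  module _ {n₁ n₂} (G₁ : Graph n₁) (G₂ : Graph n₂) where

    twice-d-2-⊕ : Fin n₁ → Fin n₂ →
                  d (G₁ ⊕ G₂) 2 + d (G₁ ⊕ G₂) 2 + (n₁ + n₂ + 2 * numEdges G₁ + 2 * numEdges G₂)
                  ≡ n₁ * n₁ + n₂ * n₂
    twice-d-2-⊕ a b = begin
      e + e + (n₁ + n₂ + 2 * m₁ + 2 * m₂)
        ≡⟨ regroup e m₁ m₂ n₁ n₂ ⟩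
      2 * (m₁ + m₂ + e) + n₁ + n₂
        ≡⟨ cong (λ q → 2 * q + n₁ + n₂) (d-2-⊕ G₁ G₂ a b) ⟩
      2 * (numPairs n₁ + numPairs n₂) + n₁ + n₂
        ≡⟨ regroup′ (numPairs n₁) (numPairs n₂) n₁ n₂ ⟩
      (2 * numPairs n₁ + n₁) + (2 * numPairs n₂ + n₂)
        ≡⟨ cong₂ _+_ (numPairs-double n₁) (numPairs-double n₂) ⟩
      n₁ * n₁ + n₂ * n₂ ∎
      where
      open ≡-Reasoning
      e m₁ m₂ : ℕ
      e = d (G₁ ⊕ G₂) 2
      m₁ = numEdges G₁
      m₂ = numEdges G₂
      regroup : ∀ e m₁ m₂ n₁ n₂ →
                e + e + (n₁ + n₂ + 2 * m₁ + 2 * m₂) ≡ 2 * (m₁ + m₂ + e) + n₁ + n₂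
      regroup = solve-∀
      regroup′ : ∀ p₁ p₂ n₁ n₂ → 2 * (p₁ + p₂) + n₁ + n₂ ≡ (2 * p₁ + n₁) + (2 * p₂ + n₂)
      regroup′ = solve-∀

    numEdges-μ-⊕ : numEdges (μ (G₁ ⊕ G₂))
                   ≡ 3 * numEdges G₁ + 3 * numEdges G₂ + 3 * n₁ * n₂ + n₁ + n₂
    numEdges-μ-⊕ = trans (numEdges-μ (G₁ ⊕ G₂))
      (trans (cong (λ m → 3 * m + (n₁ + n₂)) (numEdges-⊕ G₁ G₂))
             (expand (numEdges G₁) (numEdges G₂) n₁ n₂))
      where
      expand : ∀ m₁ m₂ n₁ n₂ →
               3 * (m₁ + m₂ + n₁ * n₂) + (n₁ + n₂) ≡ 3 * m₁ + 3 * m₂ + 3 * n₁ * n₂ + n₁ + n₂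
      expand = solve-∀

    d-2-μ-⊕ : Fin n₁ → Fin n₂ →
              d (μ (G₁ ⊕ G₂)) 2 + (3 * numEdges G₁ + 3 * numEdges G₂)
              ≡ 2 * n₁ * n₁ + 2 * n₂ * n₂ + n₁ * n₂
    d-2-μ-⊕ a b = +-cancelʳ-≡ (3 * n₁ * n₂) _ _ (begin
      e + (3 * m₁ + 3 * m₂) + 3 * n₁ * n₂
        ≡⟨ regroup e m₁ m₂ n₁ n₂ ⟩
      e + 3 * (m₁ + m₂ + n₁ * n₂)
        ≡⟨ cong (λ m → e + 3 * m) (numEdges-⊕ G₁ G₂) ⟨
      e + 3 * numEdges (G₁ ⊕ G₂)
        ≡⟨ d-2-μ (G₁ ⊕ G₂) (⊕-withinTwoSteps G₁ G₂ a b) (a ↑ˡ n₂) ⟩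
      2 * ((n₁ + n₂) * (n₁ + n₂))
        ≡⟨ expand n₁ n₂ ⟩
      2 * n₁ * n₁ + 2 * n₂ * n₂ + n₁ * n₂ + 3 * n₁ * n₂ ∎)
      where
      open ≡-Reasoning
      e m₁ m₂ : ℕ
      e = d (μ (G₁ ⊕ G₂)) 2
      m₁ = numEdges G₁
      m₂ = numEdges G₂
      regroup : ∀ e m₁ m₂ n₁ n₂ →
                e + (3 * m₁ + 3 * m₂) + 3 * n₁ * n₂ ≡ e + 3 * (m₁ + m₂ + n₁ * n₂)
      regroup = solve-∀
      expand : ∀ n₁ n₂ →
               2 * ((n₁ + n₂) * (n₁ + n₂)) ≡ 2 * n₁ * n₁ + 2 * n₂ * n₂ + n₁ * n₂ + 3 * n₁ * n₂
      expand = solve-∀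

open DiameterTwo
open import Defs hiding (sym)
open import Data.Nat using (ℕ)
open import Data.Product using (_×_)
open import Relation.Binary.PropositionalEquality using (_≡_)
open import Data.Integer using (+_; _+_; _-_; _*_)
open import Data.Rational using (½; _/_)
import Data.Rational as ℚ

import Data.Nat as ℕ
open import Data.Fin using (_↑ˡ_)
open import Data.Integer.Properties using (pos-+; pos-*; *-identityʳ)
open import Data.Integer.Tactic.RingSolver using (solve-∀)
import Data.Nat.Coprimality as Coprime
open import Data.Product using (_,_)
open import Data.Rational.Properties using (↥p/↧p≡p; *-distribˡ-+; *-distribʳ-+; *-identityˡ)
open import Relation.Binary.PropositionalEquality using (refl; sym; trans; cong; cong₂; module ≡-Reasoning)

hosoya-withinTwoSteps : ∀ {n} (G : Graph n) → WithinTwoSteps (adj G) →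
                        ∀ k → hosoya G k ≡ linQuad (+ numEdges G / 1) (+ d G 2 / 1) k
hosoya-withinTwoSteps G within 0 = refl
hosoya-withinTwoSteps G within 1 = cong (λ m → + m / 1) (d-1 G)
hosoya-withinTwoSteps G within 2 = refl
hosoya-withinTwoSteps G within (ℕ.suc (ℕ.suc (ℕ.suc k))) = cong (λ m → + m / 1) (d-3+ G within k)

pos-sub : ∀ {a b c} → a ℕ.+ b ≡ c → + c - + b ≡ + a
pos-sub {a} {b} refl = trans (cong (_- + b) (pos-+ a b)) (cancel (+ a) (+ b))
  where
  cancel : ∀ x y → x + y - y ≡ x
  cancel = solve-∀

/1-+ : ∀ a b → + (a ℕ.+ b) / 1 ≡ (+ a / 1) ℚ.+ (+ b / 1)
/1-+ a b = begin
  + (a ℕ.+ b) / 1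
    ≡⟨ cong (_/ 1) (trans (pos-+ a b) (sym (cong₂ _+_ (*-identityʳ (+ a)) (*-identityʳ (+ b))))) ⟩
  (+ a * + 1 + + b * + 1) / 1
    ≡⟨⟩
  integer a ℚ.+ integer b
    ≡⟨ cong₂ ℚ._+_ (↥p/↧p≡p (integer a)) (↥p/↧p≡p (integer b)) ⟨
  (+ a / 1) ℚ.+ (+ b / 1) ∎
  where
  open ≡-Reasoning
  -- k / 1 in normal form, on which ℚ._+_ computes.
  integer : ℕ → ℚ.ℚ
  integer k = ℚ.mkℚ (+ k) 0 (Coprime.sym (Coprime.1-coprimeTo k))

½-double : ∀ k → ½ ℚ.* (+ (k ℕ.+ k) / 1) ≡ + k / 1
½-double k = begin
  ½ ℚ.* (+ (k ℕ.+ k) / 1)  ≡⟨ cong (½ ℚ.*_) (/1-+ k k) ⟩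
  ½ ℚ.* (q ℚ.+ q)          ≡⟨ *-distribˡ-+ ½ q q ⟩
  ½ ℚ.* q ℚ.+ ½ ℚ.* q      ≡⟨ *-distribʳ-+ q ½ ½ ⟨
  (½ ℚ.+ ½) ℚ.* q          ≡⟨ *-identityˡ q ⟩
  q                        ∎
  where
  open ≡-Reasoning
  q : ℚ.ℚ
  q = + k / 1

join-coefficient : ∀ n₁ n₂ m₁ m₂ e →
  e ℕ.+ e ℕ.+ (n₁ ℕ.+ n₂ ℕ.+ 2 ℕ.* m₁ ℕ.+ 2 ℕ.* m₂) ≡ n₁ ℕ.* n₁ ℕ.+ n₂ ℕ.* n₂ →
  + n₁ * + n₁ + + n₂ * + n₂ - + n₁ - + n₂ - + 2 * + m₁ - + 2 * + m₂ ≡ + (e ℕ.+ e)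
join-coefficient n₁ n₂ m₁ m₂ e h = begin
  + n₁ * + n₁ + + n₂ * + n₂ - + n₁ - + n₂ - + 2 * + m₁ - + 2 * + m₂
    ≡⟨ regroup (+ n₁) (+ n₂) (+ m₁) (+ m₂) ⟩
  (+ n₁ * + n₁ + + n₂ * + n₂) - (+ n₁ + + n₂ + + 2 * + m₁ + + 2 * + m₂)
    ≡⟨ cong₂ _-_ squares linear ⟨
  + (n₁ ℕ.* n₁ ℕ.+ n₂ ℕ.* n₂) - + (n₁ ℕ.+ n₂ ℕ.+ 2 ℕ.* m₁ ℕ.+ 2 ℕ.* m₂)
    ≡⟨ pos-sub h ⟩
  + (e ℕ.+ e) ∎
  where
  open ≡-Reasoning
  regroup : ∀ n₁ n₂ m₁ m₂ → n₁ * n₁ + n₂ * n₂ - n₁ - n₂ - + 2 * m₁ - + 2 * m₂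
                          ≡ (n₁ * n₁ + n₂ * n₂) - (n₁ + n₂ + + 2 * m₁ + + 2 * m₂)
  regroup = solve-∀
  squares : + (n₁ ℕ.* n₁ ℕ.+ n₂ ℕ.* n₂) ≡ + n₁ * + n₁ + + n₂ * + n₂
  squares = trans (pos-+ (n₁ ℕ.* n₁) (n₂ ℕ.* n₂)) (cong₂ _+_ (pos-* n₁ n₁) (pos-* n₂ n₂))
  linear : + (n₁ ℕ.+ n₂ ℕ.+ 2 ℕ.* m₁ ℕ.+ 2 ℕ.* m₂) ≡ + n₁ + + n₂ + + 2 * + m₁ + + 2 * + m₂
  linear = trans (pos-+ (n₁ ℕ.+ n₂ ℕ.+ 2 ℕ.* m₁) (2 ℕ.* m₂)) (cong₂ _+_
    (trans (pos-+ (n₁ ℕ.+ n₂) (2 ℕ.* m₁)) (cong₂ _+_ (pos-+ n₁ n₂) (pos-* 2 m₁))) (pos-* 2 m₂))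

μ-join-coefficient : ∀ n₁ n₂ m₁ m₂ e →
  e ℕ.+ (3 ℕ.* m₁ ℕ.+ 3 ℕ.* m₂) ≡ 2 ℕ.* n₁ ℕ.* n₁ ℕ.+ 2 ℕ.* n₂ ℕ.* n₂ ℕ.+ n₁ ℕ.* n₂ →
  + 2 * + n₁ * + n₁ + + 2 * + n₂ * + n₂ + + n₁ * + n₂ - + 3 * + m₁ - + 3 * + m₂ ≡ + e
μ-join-coefficient n₁ n₂ m₁ m₂ e h = begin
  + 2 * + n₁ * + n₁ + + 2 * + n₂ * + n₂ + + n₁ * + n₂ - + 3 * + m₁ - + 3 * + m₂
    ≡⟨ regroup (+ n₁) (+ n₂) (+ m₁) (+ m₂) ⟩
  (+ 2 * + n₁ * + n₁ + + 2 * + n₂ * + n₂ + + n₁ * + n₂) - (+ 3 * + m₁ + + 3 * + m₂)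
    ≡⟨ cong₂ _-_ quadratic linear ⟨
  + (2 ℕ.* n₁ ℕ.* n₁ ℕ.+ 2 ℕ.* n₂ ℕ.* n₂ ℕ.+ n₁ ℕ.* n₂) - + (3 ℕ.* m₁ ℕ.+ 3 ℕ.* m₂)
    ≡⟨ pos-sub h ⟩
  + e ∎
  where
  open ≡-Reasoning
  regroup : ∀ n₁ n₂ m₁ m₂ → + 2 * n₁ * n₁ + + 2 * n₂ * n₂ + n₁ * n₂ - + 3 * m₁ - + 3 * m₂
                          ≡ (+ 2 * n₁ * n₁ + + 2 * n₂ * n₂ + n₁ * n₂) - (+ 3 * m₁ + + 3 * m₂)
  regroup = solve-∀
  doubleSquare : ∀ n → + (2 ℕ.* n ℕ.* n) ≡ + 2 * + n * + n
  doubleSquare n = trans (pos-* (2 ℕ.* n) n) (cong (_* + n) (pos-* 2 n))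
  quadratic : + (2 ℕ.* n₁ ℕ.* n₁ ℕ.+ 2 ℕ.* n₂ ℕ.* n₂ ℕ.+ n₁ ℕ.* n₂)
              ≡ + 2 * + n₁ * + n₁ + + 2 * + n₂ * + n₂ + + n₁ * + n₂
  quadratic = trans (pos-+ (2 ℕ.* n₁ ℕ.* n₁ ℕ.+ 2 ℕ.* n₂ ℕ.* n₂) (n₁ ℕ.* n₂)) (cong₂ _+_
    (trans (pos-+ (2 ℕ.* n₁ ℕ.* n₁) (2 ℕ.* n₂ ℕ.* n₂)) (cong₂ _+_ (doubleSquare n₁) (doubleSquare n₂)))
    (pos-* n₁ n₂))
  linear : + (3 ℕ.* m₁ ℕ.+ 3 ℕ.* m₂) ≡ + 3 * + m₁ + + 3 * + m₂
  linear = trans (pos-+ (3 ℕ.* m₁) (3 ℕ.* m₂)) (cong₂ _+_ (pos-* 3 m₁) (pos-* 3 m₂))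

corollary3p6 : ∀ {n₁ n₂ : ℕ} (G₁ : Graph n₁) (G₂ : Graph n₂) (m₁ m₂ : ℕ) →
    numEdges G₁ ≡ m₁ → numEdges G₂ ≡ m₂ →
    Connected G₁ → Connected G₂ → DiamAtLeast2 G₁ → DiamAtLeast2 G₂ →
    (∀ k → hosoya (G₁ ⊕ G₂) k ≡
       linQuad ((+ (m₁ Data.Nat.+ m₂ Data.Nat.+ n₁ Data.Nat.* n₂)) / 1)
               (½ ℚ.* ((+ n₁ * + n₁ + + n₂ * + n₂ - + n₁ - + n₂ - + 2 * + m₁ - + 2 * + m₂) / 1))
               k)
    × (∀ k → hosoya (μ (G₁ ⊕ G₂)) k ≡
       linQuad ((+ (3 Data.Nat.* m₁ Data.Nat.+ 3 Data.Nat.* m₂ Data.Nat.+ 3 Data.Nat.* n₁ Data.Nat.* n₂ Data.Nat.+ n₁ Data.Nat.+ n₂)) / 1)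
               ((+ 2 * + n₁ * + n₁ + + 2 * + n₂ * + n₂ + + n₁ * + n₂ - + 3 * + m₁ - + 3 * + m₂) / 1)
               k)
corollary3p6 {n₁} {n₂} G₁ G₂ _ _ refl refl _ _ (a , _) (b , _) =
  (λ k → trans (hosoya-withinTwoSteps H withinH k) (cong₂ (λ x y → linQuad x y k) linear quadratic)) ,
  (λ k → trans (hosoya-withinTwoSteps (μ H) withinμH k) (cong₂ (λ x y → linQuad x y k) linearμ quadraticμ))
  where
  m₁ m₂ : ℕ
  m₁ = numEdges G₁
  m₂ = numEdges G₂
  H : Graph (n₁ ℕ.+ n₂)
  H = G₁ ⊕ G₂
  withinH : WithinTwoSteps (adj H)
  withinH = ⊕-withinTwoSteps G₁ G₂ a b
  withinμH : WithinTwoSteps (adj (μ H))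
  withinμH = μ-withinTwoSteps H withinH (a ↑ˡ n₂)
  linear : + numEdges H / 1 ≡ + (m₁ ℕ.+ m₂ ℕ.+ n₁ ℕ.* n₂) / 1
  linear = cong (λ m → + m / 1) (numEdges-⊕ G₁ G₂)
  quadratic : + d H 2 / 1
              ≡ ½ ℚ.* ((+ n₁ * + n₁ + + n₂ * + n₂ - + n₁ - + n₂ - + 2 * + m₁ - + 2 * + m₂) / 1)
  quadratic = sym (trans (cong (λ z → ½ ℚ.* (z / 1))
                               (join-coefficient n₁ n₂ m₁ m₂ (d H 2) (twice-d-2-⊕ G₁ G₂ a b)))
                         (½-double (d H 2)))
  linearμ : + numEdges (μ H) / 1
            ≡ + (3 ℕ.* m₁ ℕ.+ 3 ℕ.* m₂ ℕ.+ 3 ℕ.* n₁ ℕ.* n₂ ℕ.+ n₁ ℕ.+ n₂) / 1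
  linearμ = cong (λ m → + m / 1) (numEdges-μ-⊕ G₁ G₂)
  quadraticμ : + d (μ H) 2 / 1
               ≡ (+ 2 * + n₁ * + n₁ + + 2 * + n₂ * + n₂ + + n₁ * + n₂ - + 3 * + m₁ - + 3 * + m₂) / 1
  quadraticμ = sym (cong (_/ 1) (μ-join-coefficient n₁ n₂ m₁ m₂ (d (μ H) 2) (d-2-μ-⊕ G₁ G₂ a b)))
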